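{- Let $M$ be an independent set of $\Gamma_4$. Then no two $S_M$-pairs are f-opposite.
   Context: In $\mathrm{PG}(4,q)$ a chamber is a tuple $(P,\ell,\pi,S)$ of a mutually incident point, line, plane and solid. Two chambers $(P_1,\ell_1,\pi_1,S_1)$, $(P_2,\ell_2,\pi_2,S_2)$ are opposite if $P_1\notin S_2$, $P_2\notin S_1$, $\ell_1\cap\pi_2=\emptyset$ and $\ell_2\cap\pi_1=\emptyset$. $\Gamma_4$ is the graph on chambers with adjacency being oppositeness; an independent set is a set of pairwise non-opposite chambers. A coflag is an incident line-plane pair $(\ell,\pi)$; two coflags $(\ell_1,\pi_1)$, $(\ell_2,\pi_2)$ are f-opposite if $\ell_1\cap\pi_2=\emptyset$ and $\ell_2\cap\pi_1=\emptyset$. For an independent set $M$, the $M$-weight of a coflag is the number of chambers of $M$ containing it, and the $M$-weight of a triple $(\ell,\pi,R)$ (resp. $(Q,\ell,\pi)$) is the number of chambers of $M$ containing $\ell,\pi,R$ (resp. $Q,\ell,\pi$). A coflag $(\ell,\pi)$ of $M$-weight $q+1$ or $2q+1$ is an $S_M$-pair if there is a solid $R$ such that $(\ell,\pi,R)$ has $M$-weight $q+1$. -}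

module Defs where

open import Level using (Level; _⊔_; suc)
import Data.Nat
open import Data.Nat using (ℕ; zero) renaming (suc to sucℕ; _+_ to _+ℕ_)
open import Data.Fin using (Fin) renaming (zero to fz; suc to fs)
open import Data.List using (List; length)
open import Data.List.Relation.Unary.All using (All)
open import Data.List.Relation.Unary.Any using (Any)
open import Data.List.Relation.Unary.AllPairs using (AllPairs)
open import Data.Product using (Σ; ∃; _×_; _,_)
open import Data.Sum using (_⊎_)
open import Relation.Nullary using (¬_)
open import Relation.Binary.PropositionalEquality using (_≡_)
import Relation.Binary.PropositionalEquality as ≡
open import Algebra.Bundles using (CommutativeRing)
open import Function.Bundles using (Inverse)

record FiniteField (c ℓ : Level) : Set (suc (c ⊔ ℓ)) where
  field
    commRing : CommutativeRing c ℓ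
  open CommutativeRing commRing public
  field
    1≉0     : ¬ (1# ≈ 0#)
    inverse : ∀ x → ¬ (x ≈ 0#) → ∃ λ y → (x * y) ≈ 1#
    q       : ℕ
    enum    : Inverse (≡.setoid (Fin q)) setoid

module PG4 {c ℓ : Level} (F : FiniteField c ℓ) where
  open FiniteField F

  V : Set c
  V = Fin 5 → Carrier

  _≈V_ : V → V → Set ℓ
  u ≈V v = ∀ i → u i ≈ v i

  0V : V
  0V _ = 0#

  _+V_ : V → V → V
  (u +V v) i = u i + v i

  _·V_ : Carrier → V → V
  (a ·V v) i = a * v i

  lincomb : ∀ {k} → (Fin k → Carrier) → (Fin k → V) → V
  lincomb {zero}   a b = 0V
  lincomb {sucℕ k} a b = (a fz ·V b fz) +V lincomb (λ i → a (fs i)) (λ i → b (fs i))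

  LinIndep : ∀ {k} → (Fin k → V) → Set (c ⊔ ℓ)
  LinIndep {k} b = ∀ (a : Fin k → Carrier) → lincomb a b ≈V 0V → ∀ i → a i ≈ 0#

  -- A projective subspace of projective dimension d, i.e. a vector
  -- subspace of F^5 of dimension d+1, given by a basis.
  record Sub (d : ℕ) : Set (c ⊔ ℓ) where
    constructor sub
    field
      basis : Fin (sucℕ d) → V
      indep : LinIndep basis

  _∈_ : ∀ {d} → V → Sub d → Set (c ⊔ ℓ)
  x ∈ S = ∃ λ a → x ≈V lincomb a (Sub.basis S)

  _⊆_ : ∀ {d e} → Sub d → Sub e → Set (c ⊔ ℓ)
  S ⊆ T = ∀ x → x ∈ S → x ∈ T

  _≐_ : ∀ {d} → Sub d → Sub d → Set (c ⊔ ℓ)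
  S ≐ T = S ⊆ T × T ⊆ S

  Disjoint : ∀ {d e} → Sub d → Sub e → Set (c ⊔ ℓ)
  Disjoint S T = ∀ x → x ∈ S → x ∈ T → x ≈V 0V

  Point Line Plane Solid : Set (c ⊔ ℓ)
  Point = Sub 0
  Line  = Sub 1
  Plane = Sub 2
  Solid = Sub 3

  record Chamber : Set (c ⊔ ℓ) where
    constructor chamber
    field
      P   : Point
      l   : Line
      pi  : Plane
      S   : Solid
      P⊆l  : P ⊆ l
      l⊆pi : l ⊆ pi
      pi⊆S : pi ⊆ S

  _≈C_ : Chamber → Chamber → Set (c ⊔ ℓ)
  C ≈C D = (Chamber.P C ≐ Chamber.P D) × (Chamber.l C ≐ Chamber.l D)
         × (Chamber.pi C ≐ Chamber.pi D) × (Chamber.S C ≐ Chamber.S D)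

  Opposite : Chamber → Chamber → Set (c ⊔ ℓ)
  Opposite C D = ¬ (Chamber.P C ⊆ Chamber.S D) × ¬ (Chamber.P D ⊆ Chamber.S C)
               × Disjoint (Chamber.l C) (Chamber.pi D) × Disjoint (Chamber.l D) (Chamber.pi C)

  -- a set of chambers (a predicate on chamber representations; the
  -- chambers of M are the geometric chambers having a representative in M)
  ChamberSet : Set (suc (c ⊔ ℓ))
  ChamberSet = Chamber → Set (c ⊔ ℓ)

  Independent : ChamberSet → Set (c ⊔ ℓ)
  Independent M = ∀ C D → M C → M D → ¬ Opposite C D

  -- "the number of chambers of M satisfying Q is k": there is a list of k
  -- pairwise distinct chambers of M satisfying Q such that every chamber
  -- of M satisfying Q equals one of them.
  CountIs : ChamberSet → (Chamber → Set (c ⊔ ℓ)) → ℕ → Set (c ⊔ ℓ)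
  CountIs M Q k = Σ (List Chamber) λ L →
      (length L ≡ k)
    × All (λ C → M C × Q C) L
    × AllPairs (λ C D → ¬ (C ≈C D)) L
    × (∀ C → M C → Q C → Any (C ≈C_) L)

  record Coflag : Set (c ⊔ ℓ) where
    constructor coflag
    field
      l    : Line
      pi   : Plane
      l⊆pi : l ⊆ pi

  FOpposite : Coflag → Coflag → Set (c ⊔ ℓ)
  FOpposite A B = Disjoint (Coflag.l A) (Coflag.pi B) × Disjoint (Coflag.l B) (Coflag.pi A)

  ContainsCoflag : Coflag → Chamber → Set (c ⊔ ℓ)
  ContainsCoflag A C = (Chamber.l C ≐ Coflag.l A) × (Chamber.pi C ≐ Coflag.pi A)

  ContainsTriple : Coflag → Solid → Chamber → Set (c ⊔ ℓ)
  ContainsTriple A R C = ContainsCoflag A C × (Chamber.S C ≐ R)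

  CoflagWeight : ChamberSet → Coflag → ℕ → Set (c ⊔ ℓ)
  CoflagWeight M A k = CountIs M (ContainsCoflag A) k

  TripleWeight : ChamberSet → Coflag → Solid → ℕ → Set (c ⊔ ℓ)
  TripleWeight M A R k = CountIs M (ContainsTriple A R) k

  SMPair : ChamberSet → Coflag → Set (c ⊔ ℓ)
  SMPair M A = (CoflagWeight M A (q +ℕ 1) ⊎ CoflagWeight M A (2 Data.Nat.* q +ℕ 1))
             × (∃ λ (R : Solid) → TripleWeight M A R (q +ℕ 1))

-- Two chambers through the same triple (ℓ, π, R) differ only in their point, and weight
-- q + 1 ≥ 2 provides two of them in M. So an S_M-pair A comes with a solid R_A and two chambers
-- of M whose points are distinct points of ℓ_A; likewise for B. If A and B were f-opposite, then
-- for such chambers C of A and D of B the line/plane conditions of oppositeness already hold, so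
-- independence of M forces P_C ∈ R_B or P_D ∈ R_A. Hence both points of A lie in R_B, or both
-- points of B lie in R_A. But a line ℓ_A disjoint from the plane π_B ⊆ R_B meets R_B in at most
-- one point: two of its points together with a basis of π_B would be five linearly independent
-- vectors in the four-dimensional space R_B.
module Submission where

open import Defs
open import Level using (Level; _⊔_)
open import Data.Nat using (zero; suc; _≤_; s≤s) renaming (_+_ to _+ℕ_)
open import Data.Nat.Properties using (n≢0⇒n>0; +-monoˡ-≤)
open import Data.Fin using (Fin; punchIn; punchOut) renaming (zero to fz; suc to fs)
open import Data.Fin.Properties using (punchIn-punchOut; all?; ¬∀⟶∃¬) renaming (_≟_ to _≟ᶠ_)
open import Data.Vec.Functional using (_∷_; [])
open import Data.List using () renaming (_∷_ to _∷ˡ_; [] to []ˡ)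
open import Data.List.Relation.Unary.All using () renaming (_∷_ to _∷ᵃ_)
open import Data.List.Relation.Unary.AllPairs using () renaming (_∷_ to _∷ᵖ_)
open import Data.Product using (∃; _×_; _,_; proj₁; proj₂; swap)
open import Data.Sum using (_⊎_; inj₁; inj₂; [_,_])
import Data.Sum as Sum
open import Data.Empty using (⊥-elim)
open import Relation.Nullary using (¬_; Dec; yes; no)
open import Relation.Nullary.Negation using (¬¬-map)
open import Relation.Binary.PropositionalEquality as ≡ using (_≡_; _≢_)
open import Relation.Unary.Properties using (⊆′-trans; ≐′-sym; ≐′-trans)
open import Function.Base using (_∘_)
open import Function.Bundles using (Inverse)

¬¬-∀-Fin : ∀ {a n} {X : Fin n → Set a} → (∀ i → ¬ ¬ X i) → ¬ ¬ (∀ i → X i)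
¬¬-∀-Fin {n = zero}  _   ¬∀X = ¬∀X (λ ())
¬¬-∀-Fin {n = suc n} ¬¬X ¬∀X = ¬¬X fz λ x₀ →
  ¬¬-∀-Fin (λ i → ¬¬X (fs i)) λ xs → ¬∀X λ { fz → x₀ ; (fs i) → xs i }

¬¬-∀⊎∀ : ∀ {a b m n} {X : Fin m → Set a} {Y : Fin n → Set b}
  → (∀ i j → ¬ ¬ (X i ⊎ Y j)) → ¬ ¬ ((∀ i → X i) ⊎ (∀ j → Y j))
¬¬-∀⊎∀ X⊎Y ¬∀X⊎∀Y =
  ¬¬-∀-Fin (λ i ¬Xi → ¬¬-∀-Fin (λ j ¬Yj → X⊎Y i j [ ¬Xi , ¬Yj ]) (¬∀X⊎∀Y ∘ inj₂))
           (¬∀X⊎∀Y ∘ inj₁)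

module Linear {c ℓ : Level} (F : FiniteField c ℓ) where
  open FiniteField F
  open PG4 F
  open import Relation.Binary.Reasoning.Setoid setoid
  open import Algebra.Properties.Ring ring
    using (-‿distribˡ-*; -‿distribʳ-*; -‿+-comm; -0#≈0#; +-inverseˡ-unique; +-inverseʳ-unique)
  open import Algebra.Properties.Semiring.Sum semiring
    using ( sum; sum-syntax; sum-cong-≋; sum-replicate-zero; ∑-distrib-+; ∑-comm
          ; *-distribˡ-sum; *-distribʳ-sum)
  module E = Inverse enum

  _≟_ : (x y : Carrier) → Dec (x ≈ y)
  x ≟ y with E.from x ≟ᶠ E.from y
  ... | yes eq = yes (begin
    x               ≈⟨ E.strictlyInverseˡ x ⟨
    E.to (E.from x) ≡⟨ ≡.cong E.to eq ⟩
    E.to (E.from y) ≈⟨ E.strictlyInverseˡ y ⟩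
    y               ∎)
  ... | no neq = no (λ eq → neq (E.from-cong eq))

  _⁻¹⟨_⟩ : ∀ x → ¬ x ≈ 0# → Carrier
  x ⁻¹⟨ x≉0 ⟩ = proj₁ (inverse x x≉0)

  ⁻¹-inverseˡ : ∀ x (x≉0 : ¬ x ≈ 0#) → x ⁻¹⟨ x≉0 ⟩ * x ≈ 1#
  ⁻¹-inverseˡ x x≉0 = trans (*-comm _ x) (proj₂ (inverse x x≉0))

  *-solveˡ : ∀ {a x y} (a≉0 : ¬ a ≈ 0#) → a * x ≈ y → x ≈ a ⁻¹⟨ a≉0 ⟩ * y
  *-solveˡ {a} {x} {y} a≉0 ax≈y = begin
    x                     ≈⟨ *-identityˡ x ⟨
    1# * x                ≈⟨ *-congʳ (⁻¹-inverseˡ a a≉0) ⟨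
    (a ⁻¹⟨ a≉0 ⟩ * a) * x ≈⟨ *-assoc _ a x ⟩
    a ⁻¹⟨ a≉0 ⟩ * (a * x) ≈⟨ *-congˡ ax≈y ⟩
    a ⁻¹⟨ a≉0 ⟩ * y       ∎

  sum-zero : ∀ {n} (f : Fin n → Carrier) → (∀ i → f i ≈ 0#) → ∑[ i < n ] f i ≈ 0#
  sum-zero {n} f f≈0 = trans (sum-cong-≋ f≈0) (sum-replicate-zero n)

  lincomb-coord : ∀ {k} (a : Fin k → Carrier) (b : Fin k → V) i
    → lincomb a b i ≡ ∑[ j < k ] (a j * b j i)
  lincomb-coord {zero}  a b i = ≡.refl
  lincomb-coord {suc k} a b i =
    ≡.cong (a fz * b fz i +_) (lincomb-coord (λ j → a (fs j)) (λ j → b (fs j)) i)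

  lincomb-zero : ∀ {k} (a : Fin k → Carrier) (b : Fin k → V) → (∀ j → a j ≈ 0#) → lincomb a b ≈V 0V
  lincomb-zero {k} a b a≈0 i = begin
    lincomb a b i            ≡⟨ lincomb-coord a b i ⟩
    ∑[ j < k ] (a j * b j i) ≈⟨ sum-zero _ (λ j → trans (*-congʳ (a≈0 j)) (zeroˡ _)) ⟩
    0#                       ∎

  lincomb-neg : ∀ {k} (a : Fin k → Carrier) (b : Fin k → V) i
    → lincomb (λ j → - a j) b i ≈ - lincomb a b i
  lincomb-neg {zero}  a b i = sym -0#≈0#
  lincomb-neg {suc k} a b i = trans
    (+-cong (sym (-‿distribˡ-* _ _)) (lincomb-neg (λ j → a (fs j)) (λ j → b (fs j)) i))
    (-‿+-comm _ _)

  lincomb-compose : ∀ {m n} (v : Fin m → V) (a : Fin m → Fin n → Carrier) (b : Fin n → V)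
    → (∀ j → v j ≈V lincomb (a j) b)
    → ∀ c → lincomb c v ≈V lincomb (λ i → ∑[ j < m ] (c j * a j i)) b
  lincomb-compose {m} {n} v a b v≈ab c k = begin
    lincomb c v k
      ≡⟨ lincomb-coord c v k ⟩
    ∑[ j < m ] (c j * v j k)
      ≈⟨ sum-cong-≋ (λ j → *-congˡ (trans (v≈ab j k) (reflexive (lincomb-coord (a j) b k)))) ⟩
    ∑[ j < m ] (c j * ∑[ i < n ] (a j i * b i k))
      ≈⟨ sum-cong-≋ (λ j → *-distribˡ-sum (c j) (λ i → a j i * b i k)) ⟩
    ∑[ j < m ] ∑[ i < n ] (c j * (a j i * b i k))
      ≈⟨ ∑-comm (λ j i → c j * (a j i * b i k)) ⟩
    ∑[ i < n ] ∑[ j < m ] (c j * (a j i * b i k))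
      ≈⟨ sum-cong-≋ (λ i → sum-cong-≋ (λ j → sym (*-assoc (c j) (a j i) (b i k)))) ⟩
    ∑[ i < n ] ∑[ j < m ] ((c j * a j i) * b i k)
      ≈⟨ sum-cong-≋ (λ i → *-distribʳ-sum (b i k) (λ j → c j * a j i)) ⟨
    ∑[ i < n ] (∑[ j < m ] (c j * a j i) * b i k)
      ≡⟨ lincomb-coord (λ i → ∑[ j < m ] (c j * a j i)) b k ⟨
    lincomb (λ i → ∑[ j < m ] (c j * a j i)) b k
      ∎

  δ : ∀ {n} → Fin n → Fin n → Carrier
  δ fz     fz     = 1#
  δ fz     (fs _) = 0#
  δ (fs _) fz     = 0#
  δ (fs j) (fs i) = δ j i

  lincomb-δ : ∀ {n} (j : Fin n) (b : Fin n → V) → lincomb (δ j) b ≈V b j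
  lincomb-δ fz     b k =
    trans (+-cong (*-identityˡ _) (lincomb-zero _ (λ i → b (fs i)) (λ _ → refl) k)) (+-identityʳ _)
  lincomb-δ (fs j) b k =
    trans (+-cong (zeroˡ _) (lincomb-δ j (λ i → b (fs i)) k)) (+-identityˡ _)

  ∈-cong : ∀ {d} (S : Sub d) {x y} → x ≈V y → y ∈ S → x ∈ S
  ∈-cong S x≈y (a , y≈) = a , λ k → trans (x≈y k) (y≈ k)

  basis∈ : ∀ {d} (S : Sub d) j → Sub.basis S j ∈ S
  basis∈ S j = δ j , λ k → sym (lincomb-δ j (Sub.basis S) k)

  ∈-lincomb : ∀ {m d} (S : Sub d) (v : Fin m → V) → (∀ j → v j ∈ S) → ∀ c → lincomb c v ∈ S
  ∈-lincomb {m} S v v∈S c =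
    (λ i → ∑[ j < m ] (c j * proj₁ (v∈S j) i)) ,
    lincomb-compose v (λ j → proj₁ (v∈S j)) (Sub.basis S) (λ j → proj₂ (v∈S j)) c

  -- One step of Gaussian elimination on the rows of w, with pivot w fz i₀.
  module Elimination {m n} (w : Fin (suc m) → Fin (suc n) → Carrier) (i₀ : Fin (suc n))
                     (pivot≉0 : ¬ w fz i₀ ≈ 0#) where
    t : Carrier
    t = w fz i₀ ⁻¹⟨ pivot≉0 ⟩

    reduced : Fin m → Fin (suc n) → Carrier
    reduced j i = w (fs j) i + - ((w (fs j) i₀ * t) * w fz i)

    reduced-pivot : ∀ j → reduced j i₀ ≈ 0#
    reduced-pivot j = begin
      a + - ((a * t) * w fz i₀) ≈⟨ +-congˡ (-‿cong (*-assoc a t (w fz i₀))) ⟩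
      a + - (a * (t * w fz i₀)) ≈⟨ +-congˡ (-‿cong (*-congˡ (⁻¹-inverseˡ (w fz i₀) pivot≉0))) ⟩
      a + - (a * 1#)            ≈⟨ +-congˡ (-‿cong (*-identityʳ a)) ⟩
      a + - a                   ≈⟨ -‿inverseʳ a ⟩
      0#                        ∎
      where a = w (fs j) i₀

    lift : (Fin m → Carrier) → Fin (suc m) → Carrier
    lift d = - (∑[ j < m ] (d j * w (fs j) i₀) * t) ∷ d

    lift-sum : ∀ (d : Fin m → Carrier) i
      → ∑[ j < suc m ] (lift d j * w j i) ≈ ∑[ j < m ] (d j * reduced j i)
    lift-sum d i = begin
      - (s * t) * w fz i + ∑[ j < m ] (d j * w (fs j) i)
        ≈⟨ +-comm _ _ ⟩
      ∑[ j < m ] (d j * w (fs j) i) + - (s * t) * w fz i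
        ≈⟨ +-congˡ (negate-scaled s t (w fz i)) ⟩
      ∑[ j < m ] (d j * w (fs j) i) + s * - (t * w fz i)
        ≈⟨ +-congˡ (*-distribʳ-sum (- (t * w fz i)) (λ j → d j * w (fs j) i₀)) ⟩
      ∑[ j < m ] (d j * w (fs j) i) + ∑[ j < m ] ((d j * w (fs j) i₀) * - (t * w fz i))
        ≈⟨ ∑-distrib-+ (λ j → d j * w (fs j) i) (λ j → (d j * w (fs j) i₀) * - (t * w fz i)) ⟨
      ∑[ j < m ] (d j * w (fs j) i + (d j * w (fs j) i₀) * - (t * w fz i))
        ≈⟨ sum-cong-≋ (λ j → expand (d j) (w (fs j) i) (w (fs j) i₀) (w fz i)) ⟨
      ∑[ j < m ] (d j * reduced j i)
        ∎
      where
      s : Carrier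
      s = ∑[ j < m ] (d j * w (fs j) i₀)

      negate-scaled : ∀ x y z → - (x * y) * z ≈ x * - (y * z)
      negate-scaled x y z = begin
        - (x * y) * z   ≈⟨ -‿distribˡ-* (x * y) z ⟨
        - ((x * y) * z) ≈⟨ -‿cong (*-assoc x y z) ⟩
        - (x * (y * z)) ≈⟨ -‿distribʳ-* x (y * z) ⟩
        x * - (y * z)   ∎

      expand : ∀ e x a z → e * (x + - ((a * t) * z)) ≈ e * x + (e * a) * - (t * z)
      expand e x a z = begin
        e * (x + - ((a * t) * z))     ≈⟨ distribˡ e x _ ⟩
        e * x + e * - ((a * t) * z)   ≈⟨ +-congˡ (-‿distribʳ-* e _) ⟨
        e * x + - (e * ((a * t) * z)) ≈⟨ +-congˡ (-‿cong (*-congˡ (*-assoc a t z))) ⟩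
        e * x + - (e * (a * (t * z))) ≈⟨ +-congˡ (-‿cong (*-assoc e a (t * z))) ⟨
        e * x + - ((e * a) * (t * z)) ≈⟨ +-congˡ (-‿distribʳ-* (e * a) (t * z)) ⟩
        e * x + (e * a) * - (t * z)   ∎

    extend : ∀ (d : Fin m → Carrier)
      → (∀ i → ∑[ j < m ] (d j * reduced j (punchIn i₀ i)) ≈ 0#)
      → ∀ i → ∑[ j < m ] (d j * reduced j i) ≈ 0#
    extend d rel i with i₀ ≟ᶠ i
    ... | yes ≡.refl =
      sum-zero (λ j → d j * reduced j i₀) (λ j → trans (*-congˡ (reduced-pivot j)) (zeroʳ (d j)))
    ... | no i₀≢i =
      ≡.subst (λ i → ∑[ j < m ] (d j * reduced j i) ≈ 0#) (punchIn-punchOut i₀≢i) (rel (punchOut i₀≢i))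

  Nontrivial : ∀ {m} → (Fin m → Carrier) → Set ℓ
  Nontrivial a = ∃ λ j → ¬ a j ≈ 0#

  dependent : ∀ k (w : Fin (suc k) → Fin k → Carrier)
    → ∃ λ a → Nontrivial a × ∀ i → ∑[ j < suc k ] (a j * w j i) ≈ 0#
  dependent zero    w = (λ _ → 1#) , (fz , 1≉0) , λ ()
  dependent (suc k) w with all? (λ i → w fz i ≟ 0#)
  ... | yes w₀≈0 = (1# ∷ λ _ → 0#) , (fz , 1≉0) , λ i → trans
    (+-cong (trans (*-identityˡ _) (w₀≈0 i)) (sum-zero (λ j → 0# * w (fs j) i) (λ j → zeroˡ _)))
    (+-identityˡ 0#)
  ... | no w₀≉0 with ¬∀⟶∃¬ (suc k) (λ i → w fz i ≈ 0#) (λ i → w fz i ≟ 0#) w₀≉0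
  ... | i₀ , pivot≉0 with dependent k (λ j i → Elimination.reduced w i₀ pivot≉0 j (punchIn i₀ i))
  ... | d , (j , dj≉0) , rel = lift d , (fs j , dj≉0) , λ i → trans (lift-sum d i) (extend d rel i)
    where open Elimination w i₀ pivot≉0

  ¬LinIndep-overfull : ∀ {d} (S : Sub d) (v : Fin (suc (suc d)) → V) → (∀ j → v j ∈ S) → ¬ LinIndep v
  ¬LinIndep-overfull {d} S v v∈S indep with dependent (suc d) (λ j → proj₁ (v∈S j))
  ... | a , (j , aj≉0) , rel = aj≉0 (indep a av≈0 j)
    where
    av≈0 : lincomb a v ≈V 0V
    av≈0 k = trans (lincomb-compose v (λ j → proj₁ (v∈S j)) (Sub.basis S) (λ j → proj₂ (v∈S j)) a k)
                   (lincomb-zero _ (Sub.basis S) rel k)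

  rep : Point → V
  rep P = Sub.basis P fz

  rep≉0 : (P : Point) → ¬ rep P ≈V 0V
  rep≉0 P rep≈0 =
    1≉0 (Sub.indep P (λ _ → 1#) (λ k → trans (+-identityʳ _) (trans (*-identityˡ _) (rep≈0 k))) fz)

  rep∈⇒⊆ : ∀ {d} (P : Point) (T : Sub d) → rep P ∈ T → P ⊆ T
  rep∈⇒⊆ P T rep∈T x (α , x≈) = ∈-cong T x≈ (∈-lincomb T (λ _ → rep P) (λ _ → rep∈T) α)

  proportional⇒⊆ : ∀ (P P' : Point) {s} → rep P ≈V (s ·V rep P') → P ⊆ P'
  proportional⇒⊆ P P' {s} rep≈ = rep∈⇒⊆ P P' (∈-cong P' rep≈ ((λ _ → s) , λ k → sym (+-identityʳ _)))

  proportional : ∀ {a b} {u w : V} (a≉0 : ¬ a ≈ 0#) → (∀ k → a * u k + b * w k ≈ 0#)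
    → u ≈V ((- (a ⁻¹⟨ a≉0 ⟩ * b)) ·V w)
  proportional {a} {b} {u} {w} a≉0 rel k = begin
    u k                         ≈⟨ *-solveˡ a≉0 (+-inverseˡ-unique _ _ (rel k)) ⟩
    a ⁻¹⟨ a≉0 ⟩ * - (b * w k)   ≈⟨ -‿distribʳ-* _ _ ⟨
    - (a ⁻¹⟨ a≉0 ⟩ * (b * w k)) ≈⟨ -‿cong (*-assoc _ b (w k)) ⟨
    - ((a ⁻¹⟨ a≉0 ⟩ * b) * w k) ≈⟨ -‿distribˡ-* _ (w k) ⟩
    - (a ⁻¹⟨ a≉0 ⟩ * b) * w k   ∎

  distinct-points-coefficient : (P P' : Point) → ¬ (P ≐ P') → ∀ a b
    → (∀ k → a * rep P k + b * rep P' k ≈ 0#) → a ≈ 0#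
  distinct-points-coefficient P P' P≠P' a b rel with a ≟ 0#
  ... | yes a≈0 = a≈0
  ... | no a≉0  = ⊥-elim (P≠P' ( proportional⇒⊆ P P' (proportional a≉0 rel)
                               , proportional⇒⊆ P' P (proportional b≉0 (λ k → trans (+-comm _ _) (rel k)))))
    where
    b≉0 : ¬ b ≈ 0#
    b≉0 b≈0 = rep≉0 P λ k → trans (proportional a≉0 rel k)
      (trans (*-congʳ (trans (-‿cong (trans (*-congˡ b≈0) (zeroʳ _))) -0#≈0#)) (zeroˡ _))

  distinct-points-independent : (P P' : Point) → ¬ (P ≐ P') → LinIndep (rep P ∷ rep P' ∷ [])
  distinct-points-independent P P' P≠P' a rel = λ
    { fz      → distinct-points-coefficient P P' P≠P' _ _ rel₂
    ; (fs fz) → distinct-points-coefficient P' P (P≠P' ∘ swap) _ _ (λ k → trans (+-comm _ _) (rel₂ k))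
    }
    where
    rel₂ : ∀ k → a fz * rep P k + a (fs fz) * rep P' k ≈ 0#
    rel₂ k = trans (+-congˡ (sym (+-identityʳ _))) (rel k)

  distinct-points-plane-independent : (l : Line) (π : Plane) (P P' : Point)
    → Disjoint l π → P ⊆ l → P' ⊆ l → ¬ (P ≐ P') → LinIndep (rep P ∷ rep P' ∷ Sub.basis π)
  distinct-points-plane-independent l π P P' disj P⊆l P'⊆l P≠P' a rel = a≈0
    where
    aₗ : Fin 2 → Carrier
    aₗ = a fz ∷ a (fs fz) ∷ []

    aπ : Fin 3 → Carrier
    aπ j = a (fs (fs j))

    x y : V
    x = lincomb aₗ (rep P ∷ rep P' ∷ [])
    y = lincomb aπ (Sub.basis π)

    x+y≈0 : ∀ k → x k + y k ≈ 0#
    x+y≈0 k = begin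
      (a fz * rep P k + (a (fs fz) * rep P' k + 0#)) + y k ≈⟨ +-assoc _ _ (y k) ⟩
      a fz * rep P k + ((a (fs fz) * rep P' k + 0#) + y k) ≈⟨ +-congˡ (+-assoc _ 0# (y k)) ⟩
      a fz * rep P k + (a (fs fz) * rep P' k + (0# + y k)) ≈⟨ +-congˡ (+-congˡ (+-identityˡ (y k))) ⟩
      a fz * rep P k + (a (fs fz) * rep P' k + y k)        ≈⟨ rel k ⟩
      0#                                                   ∎

    x∈l : x ∈ l
    x∈l = ∈-lincomb l (rep P ∷ rep P' ∷ [])
      (λ { fz → P⊆l _ (basis∈ P fz) ; (fs fz) → P'⊆l _ (basis∈ P' fz) }) aₗ

    x∈π : x ∈ π
    x∈π = (λ j → - aπ j) , λ k →
      trans (+-inverseˡ-unique _ _ (x+y≈0 k)) (sym (lincomb-neg aπ (Sub.basis π) k))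

    x≈0 : x ≈V 0V
    x≈0 = disj x x∈l x∈π

    y≈0 : y ≈V 0V
    y≈0 k = trans (+-inverseʳ-unique _ _ (x+y≈0 k)) (trans (-‿cong (x≈0 k)) -0#≈0#)

    a≈0 : ∀ j → a j ≈ 0#
    a≈0 fz          = distinct-points-independent P P' P≠P' aₗ x≈0 fz
    a≈0 (fs fz)     = distinct-points-independent P P' P≠P' aₗ x≈0 (fs fz)
    a≈0 (fs (fs j)) = Sub.indep π aπ y≈0 j

  disjoint-line-meets-solid-once : (l : Line) (π : Plane) (R : Solid) (P P' : Point)
    → Disjoint l π → π ⊆ R → P ⊆ l → P' ⊆ l → P ⊆ R → P' ⊆ R → ¬ ¬ (P ≐ P')
  disjoint-line-meets-solid-once l π R P P' disj π⊆R P⊆l P'⊆l P⊆R P'⊆R P≠P' =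
    ¬LinIndep-overfull R (rep P ∷ rep P' ∷ Sub.basis π) ∈R
      (distinct-points-plane-independent l π P P' disj P⊆l P'⊆l P≠P')
    where
    ∈R : ∀ j → (rep P ∷ rep P' ∷ Sub.basis π) j ∈ R
    ∈R fz          = P⊆R _ (basis∈ P fz)
    ∈R (fs fz)     = P'⊆R _ (basis∈ P' fz)
    ∈R (fs (fs j)) = π⊆R _ (basis∈ π j)

module Incidence {c ℓ : Level} (F : FiniteField c ℓ) where
  open FiniteField F using (q; enum; 0#)
  open PG4 F
  open Chamber
  open Linear F using (disjoint-line-meets-solid-once)

  -- Stated for predicates (like ⊆′-trans and ≐′-trans): the subspaces of Disjoint could not be
  -- recovered by unification, since Disjoint S T unfolds to a statement about x ∈ S and x ∈ T.
  Disjoint-mono : ∀ {a b z} {X : Set a} {B B' C C' : X → Set b} {Z : X → Set z}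
    → (∀ x → B' x → B x) → (∀ x → C' x → C x)
    → (∀ x → B x → C x → Z x) → ∀ x → B' x → C' x → Z x
  Disjoint-mono B'⊆B C'⊆C disj x x∈B' x∈C' = disj x (B'⊆B x x∈B') (C'⊆C x x∈C')

  q≢0 : q ≢ 0
  q≢0 q≡0 with ≡.subst Fin q≡0 (Inverse.from enum 0#)
  ... | ()

  record TwoDistinct (M : ChamberSet) (Q : Chamber → Set (c ⊔ ℓ)) : Set (c ⊔ ℓ) where
    field
      chambers  : Fin 2 → Chamber
      ∈M        : ∀ i → M (chambers i)
      satisfies : ∀ i → Q (chambers i)
      distinct  : ¬ (chambers fz ≈C chambers (fs fz))

  count≥2⇒TwoDistinct : ∀ {M Q k} → CountIs M Q k → 2 ≤ k → TwoDistinct M Q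
  count≥2⇒TwoDistinct ([]ˡ , ≡.refl , _) ()
  count≥2⇒TwoDistinct (_ ∷ˡ []ˡ , ≡.refl , _) (s≤s ())
  count≥2⇒TwoDistinct (C ∷ˡ C' ∷ˡ _ , _ , C∈ ∷ᵃ C'∈ ∷ᵃ _ , (C≉C' ∷ᵃ _) ∷ᵖ _ , _) _ = record
    { chambers  = C ∷ C' ∷ []
    ; ∈M        = λ { fz → proj₁ C∈ ; (fs fz) → proj₁ C'∈ }
    ; satisfies = λ { fz → proj₂ C∈ ; (fs fz) → proj₂ C'∈ }
    ; distinct  = C≉C'
    }

  triple-weight⇒TwoDistinct : ∀ {M} A R → TripleWeight M A R (q +ℕ 1) → TwoDistinct M (ContainsTriple A R)
  triple-weight⇒TwoDistinct {M} A R w =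
    count≥2⇒TwoDistinct {M} {ContainsTriple A R} w (+-monoˡ-≤ 1 (n≢0⇒n>0 q≢0))

  distinct-points : ∀ A R C C' → ContainsTriple A R C → ContainsTriple A R C' → ¬ (C ≈C C') → ¬ (P C ≐ P C')
  distinct-points _ _ _ _ ((lA , πA) , SR) ((lA' , πA') , SR') C≉C' P≐P' =
    C≉C' (P≐P' , ≐′-trans lA (≐′-sym lA') , ≐′-trans πA (≐′-sym πA') , ≐′-trans SR (≐′-sym SR'))

  module _ {M : ChamberSet} (A : Coflag) (R : Solid) (T : TwoDistinct M (ContainsTriple A R)) where
    open TwoDistinct T

    plane⊆solid : Coflag.pi A ⊆ R
    plane⊆solid = ⊆′-trans (proj₂ (proj₂ (proj₁ (satisfies fz))))
                           (⊆′-trans (pi⊆S (chambers fz)) (proj₁ (proj₂ (satisfies fz))))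

    points-not-all-in : (π : Plane) (R' : Solid) → Disjoint (Coflag.l A) π → π ⊆ R'
      → ¬ (∀ i → P (chambers i) ⊆ R')
    points-not-all-in π R' disj π⊆R' all⊆R' =
      disjoint-line-meets-solid-once (Coflag.l A) π R' (P (chambers fz)) (P (chambers (fs fz)))
        disj π⊆R' (point⊆line fz) (point⊆line (fs fz)) (all⊆R' fz) (all⊆R' (fs fz))
        (distinct-points A R (chambers fz) (chambers (fs fz)) (satisfies fz) (satisfies (fs fz)) distinct)
      where
      point⊆line : ∀ i → P (chambers i) ⊆ Coflag.l A
      point⊆line i = ⊆′-trans (P⊆l (chambers i)) (proj₁ (proj₁ (proj₁ (satisfies i))))

  independent⇒point-in-solid : ∀ {M} → Independent M → ∀ C D → M C → M D
    → Disjoint (l C) (pi D) → Disjoint (l D) (pi C) → ¬ ¬ (P C ⊆ S D ⊎ P D ⊆ S C)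
  independent⇒point-in-solid ind C D C∈M D∈M disj disj' ¬incident =
    ind C D C∈M D∈M (¬incident ∘ inj₁ , ¬incident ∘ inj₂ , disj , disj')

  f-opposite⇒point-in-solid : ∀ {M} → Independent M → ∀ A B RA RB C D → FOpposite A B → M C → M D
    → ContainsTriple A RA C → ContainsTriple B RB D → ¬ ¬ (P C ⊆ RB ⊎ P D ⊆ RA)
  f-opposite⇒point-in-solid ind A B RA RB C D (A⊥B , B⊥A) C∈M D∈M ((lC , πC) , SC) ((lD , πD) , SD) =
    ¬¬-map (Sum.map (λ C⊆D → ⊆′-trans C⊆D (proj₁ SD)) (λ D⊆C → ⊆′-trans D⊆C (proj₁ SC)))
      (independent⇒point-in-solid ind C D C∈M D∈M
        (Disjoint-mono (proj₁ lC) (proj₁ πD) A⊥B) (Disjoint-mono (proj₁ lD) (proj₁ πC) B⊥A))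

lemma3p5 : ∀ {c ℓ : Level} (F : FiniteField c ℓ) (M : PG4.ChamberSet F)
    → PG4.Independent F M
    → ∀ (A B : PG4.Coflag F) → PG4.SMPair F M A → PG4.SMPair F M B
    → ¬ PG4.FOpposite F A B
lemma3p5 F M ind A B (_ , RA , wA) (_ , RB , wB) A⊥B =
  ¬¬-∀⊎∀ incident
    [ points-not-all-in A RA TA (Coflag.pi B) RB (proj₁ A⊥B) (plane⊆solid B RB TB)
    , points-not-all-in B RB TB (Coflag.pi A) RA (proj₂ A⊥B) (plane⊆solid A RA TA) ]
  where
  open PG4 F
  open Incidence F
  open TwoDistinct

  TA : TwoDistinct M (ContainsTriple A RA)
  TA = triple-weight⇒TwoDistinct A RA wA

  TB : TwoDistinct M (ContainsTriple B RB)
  TB = triple-weight⇒TwoDistinct B RB wB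

  incident : ∀ i j → ¬ ¬ (Chamber.P (chambers TA i) ⊆ RB ⊎ Chamber.P (chambers TB j) ⊆ RA)
  incident i j =
    f-opposite⇒point-in-solid ind A B RA RB _ _ A⊥B (∈M TA i) (∈M TB j) (satisfies TA i) (satisfies TB j)
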